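{- If $D=(X,\mathcal{B})$ is a covering design, then \[\frac{\min\{r_x:x\in X\}}{|\mathcal{B}|} \leq L(D) \leq \frac{\max\{|B|:B \in \mathcal{B}\}}{|X|}.\] In particular, $L(D)=\frac{r}{|\mathcal{B}|}$ if $r_x=r$ for all $x \in X$ and $|B|=|B'|$ for all $B,B' \in \mathcal{B}$.
   Context: A covering design is a pair $(X,\mathcal{B})$ with $X$ a finite set of points and $\mathcal{B}$ a finite multiset of subsets of $X$ (blocks, counted with multiplicity) such that every pair of distinct points lies together in at least one block. For $x\in X$, $r_x$ is the number of blocks containing $x$. A weighting of $X$ assigns nonnegative reals, $w(S)=\sum_{x\in S}w(x)$, normalised means $w(X)=1$. $L(D,w)=\max\{w(B):B\in\mathcal{B}\}$ and $L(D)$ is the infimum of $L(D,w)$ over normalised weightings $w$ of $X$.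
   Formalization: Weightings of X take nonnegative rational values instead of nonnegative reals, so L(D) is taken as the infimum of L(D,w) over rational normalised weightings. -}

module Defs where

open import Data.Nat using (ℕ; zero; suc) renaming (_+_ to _+ℕ_; _⊔_ to _⊔ℕ_; _⊓_ to _⊓ℕ_)
open import Data.Bool using (true; false; if_then_else_)
open import Data.Fin using (Fin; zero; suc)
open import Data.Fin.Subset using (Subset; _∈_; ∣_∣)
open import Data.Vec using (lookup)
open import Data.Integer using (+_)
open import Data.Rational using (ℚ; 0ℚ; 1ℚ; _+_; _⊔_; _≤_; _<_; _/_)
open import Data.Product using (Σ; _×_; ∃)
open import Relation.Binary.PropositionalEquality using (_≡_; _≢_)

sumℚ : ∀ {n} → (Fin n → ℚ) → ℚ
sumℚ {zero}  f = 0ℚ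
sumℚ {suc n} f = f zero + sumℚ (λ i → f (suc i))

sumℕ : ∀ {n} → (Fin n → ℕ) → ℕ
sumℕ {zero}  f = 0
sumℕ {suc n} f = f zero +ℕ sumℕ (λ i → f (suc i))

maxℚ : ∀ {n} → (Fin (suc n) → ℚ) → ℚ
maxℚ {zero}  f = f zero
maxℚ {suc n} f = f zero ⊔ maxℚ (λ i → f (suc i))

maxℕ : ∀ {n} → (Fin (suc n) → ℕ) → ℕ
maxℕ {zero}  f = f zero
maxℕ {suc n} f = f zero ⊔ℕ maxℕ (λ i → f (suc i))

minℕ : ∀ {n} → (Fin (suc n) → ℕ) → ℕ
minℕ {zero}  f = f zero
minℕ {suc n} f = f zero ⊓ℕ minℕ (λ i → f (suc i))

-- A design on point set X = Fin v with b blocks (a multiset of blocks,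
-- given as an indexed family, so repeated blocks are allowed).
Design : ℕ → ℕ → Set
Design v b = Fin b → Subset v

IsCovering : ∀ {v b} → Design v b → Set
IsCovering {v} {b} B = (x y : Fin v) → x ≢ y → ∃ λ (i : Fin b) → (x ∈ B i) × (y ∈ B i)

rep : ∀ {v b} → Design v b → Fin v → ℕ
rep B x = sumℕ (λ i → if lookup (B i) x then 1 else 0)

Weighting : ℕ → Set
Weighting v = Fin v → ℚ

weight : ∀ {v} → Weighting v → Subset v → ℚ
weight w S = sumℚ (λ x → if lookup S x then w x else 0ℚ)

Normalised : ∀ {v} → Weighting v → Set
Normalised {v} w = ((x : Fin v) → 0ℚ ≤ w x) × (sumℚ w ≡ 1ℚ)

Lw : ∀ {v b} → Design v (suc b) → Weighting v → ℚ
Lw B w = maxℚ (λ i → weight w (B i))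

-- "a ≤ L(D)": a is a lower bound of {L(D,w) : w normalised}.
_≤LD_ : ∀ {v b} → ℚ → Design v (suc b) → Set
_≤LD_ {v} a B = (w : Weighting v) → Normalised w → a ≤ Lw B w

-- "L(D) ≤ a": inf {L(D,w)} ≤ a, i.e. for every ε > 0 some normalised w has L(D,w) < a + ε.
_LD≤_ : ∀ {v b} → Design v (suc b) → ℚ → Set
_LD≤_ {v} B a = (ε : ℚ) → 0ℚ < ε → Σ (Weighting v) λ w → Normalised w × (Lw B w < a + ε)

_LD≡_ : ∀ {v b} → Design v (suc b) → ℚ → Set
B LD≡ a = (a ≤LD B) × (B LD≤ a)

{-# OPTIONS --safe #-}
module Submission where

-- Counting incidences twice, any weighting w has ∑_B w(B) = ∑_x r_x w(x) ≥ (min r_x) · w(X), and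
-- L(D,w), the largest block weight, is at least the average ∑_B w(B) / |𝓑|: this is the lower bound.
-- The uniform weighting gives each block B the weight |B| / |X|: this is the upper bound.  If all
-- r_x = r and all blocks have the same size, the uniform weighting gives every block the same
-- weight, which the double count ∑_B w(B) = r forces to be r / |𝓑|.

open import Defs
open import Data.Nat using (ℕ; suc)
open import Data.Fin using (Fin)
open import Data.Fin.Subset using (∣_∣)
open import Data.Integer using (+_)
open import Data.Rational using (_/_)
open import Data.Product using (_×_)
open import Relation.Binary.PropositionalEquality using (_≡_)

open import Data.Bool using (Bool; true; false; if_then_else_)
open import Data.Fin using (zero; suc)
open import Data.Fin.Subset using (Subset)
import Data.Integer as ℤ
import Data.Integer.Properties as ℤ
open import Data.Integer.Tactic.RingSolver using (solve-∀)
open import Data.Nat using (zero; z≤n; s≤s)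
import Data.Nat as ℕ
import Data.Nat.Properties as ℕ
import Data.Nat.Tactic.RingSolver as ℕ-Solver
open import Data.Product using (_,_)
open import Data.Rational using (ℚ; 0ℚ; 1ℚ; _+_; _≤_; _<_; toℚᵘ)
open import Data.Rational.Properties
open import Algebra.Properties.CommutativeMonoid.Sum +-0-commutativeMonoid
  using (sum; sum-syntax; sum-cong-≗; sum-replicate; sum-replicate-zero; ∑-comm; ∑-distrib-+)
open import Algebra.Properties.Monoid.Mult +-0-monoid using () renaming (_×_ to _·_)
open import Data.Rational.Unnormalised as ℚᵘ using (mkℚᵘ; *≡*)
import Data.Rational.Unnormalised.Properties as ℚᵘ
open import Data.Vec using ([]; _∷_; lookup)
open import Function using (_∘_)
open import Relation.Binary.PropositionalEquality using (refl; sym; trans; cong; subst; module ≡-Reasoning)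

-- `+ a / suc d` is definitionally `fromℚᵘ (mkℚᵘ (+ a) d)`.
/≡/-cross : ∀ a b d e → a ℕ.* suc e ≡ b ℕ.* suc d → + a / suc d ≡ + b / suc e
/≡/-cross a b d e eq = fromℚᵘ-cong {mkℚᵘ (+ a) d} {mkℚᵘ (+ b) e} (*≡* (begin
  + a ℤ.* + suc e  ≡⟨ ℤ.pos-* a (suc e) ⟨
  + (a ℕ.* suc e)  ≡⟨ cong +_ eq ⟩
  + (b ℕ.* suc d)  ≡⟨ ℤ.pos-* b (suc d) ⟩
  + b ℤ.* + suc d  ∎))
  where open ≡-Reasoning

/-+-/ : ∀ a b d → + a / suc d + + b / suc d ≡ + (a ℕ.+ b) / suc d
/-+-/ a b d = toℚᵘ-injective (begin
  toℚᵘ (+ a / suc d + + b / suc d)            ≈⟨ toℚᵘ-homo-+ (+ a / suc d) (+ b / suc d) ⟩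
  toℚᵘ (+ a / suc d) ℚᵘ.+ toℚᵘ (+ b / suc d)  ≈⟨ ℚᵘ.+-cong (toℚᵘ-fromℚᵘ (mkℚᵘ (+ a) d)) (toℚᵘ-fromℚᵘ (mkℚᵘ (+ b) d)) ⟩
  mkℚᵘ (+ a) d ℚᵘ.+ mkℚᵘ (+ b) d              ≈⟨ *≡* (common-denominator (+ a) (+ b) (+ suc d)) ⟩
  mkℚᵘ (+ (a ℕ.+ b)) d                        ≈⟨ toℚᵘ-fromℚᵘ (mkℚᵘ (+ (a ℕ.+ b)) d) ⟨
  toℚᵘ (+ (a ℕ.+ b) / suc d)                  ∎)
  where
  open import Relation.Binary.Reasoning.Setoid ℚᵘ.≃-setoid
  common-denominator : ∀ x y z → (x ℤ.* z ℤ.+ y ℤ.* z) ℤ.* z ≡ (x ℤ.+ y) ℤ.* (z ℤ.* z)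
  common-denominator = solve-∀

·-/ : ∀ n m d → n · (+ m / suc d) ≡ + (n ℕ.* m) / suc d
·-/ zero    m d = sym (0/n≡0 (suc d))
·-/ (suc n) m d = trans (cong (_+_ (+ m / suc d)) (·-/ n m d)) (/-+-/ m (n ℕ.* m) d)

·-/-cancel : ∀ m d → suc d · (+ m / suc d) ≡ m · 1ℚ
·-/-cancel m d = begin
  suc d · (+ m / suc d)    ≡⟨ ·-/ (suc d) m d ⟩
  + (suc d ℕ.* m) / suc d  ≡⟨ /≡/-cross (suc d ℕ.* m) (m ℕ.* 1) d 0 (reorder m d) ⟩
  + (m ℕ.* 1) / 1          ≡⟨ ·-/ m 1 0 ⟨
  m · 1ℚ                   ∎
  where
  open ≡-Reasoning
  reorder : ∀ m d → suc d ℕ.* m ℕ.* 1 ≡ m ℕ.* 1 ℕ.* suc d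
  reorder = ℕ-Solver.solve-∀

·-monoʳ-≤ : ∀ n {p q} → p ≤ q → n · p ≤ n · q
·-monoʳ-≤ zero    p≤q = ≤-refl
·-monoʳ-≤ (suc n) p≤q = +-mono-≤ p≤q (·-monoʳ-≤ n p≤q)

·-monoʳ-< : ∀ n {p q} → p < q → suc n · p < suc n · q
·-monoʳ-< n p<q = +-mono-<-≤ p<q (·-monoʳ-≤ n (<⇒≤ p<q))

·-cancelˡ-≤ : ∀ n {p q} → suc n · p ≤ suc n · q → p ≤ q
·-cancelˡ-≤ n np≤nq = ≮⇒≥ (λ q<p → <-irrefl refl (<-≤-trans (·-monoʳ-< n q<p) np≤nq))

·-nonNeg : ∀ n {p} → 0ℚ ≤ p → 0ℚ ≤ n · p
·-nonNeg zero    0≤p = ≤-refl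
·-nonNeg (suc n) 0≤p = +-mono-≤ 0≤p (·-nonNeg n 0≤p)

·-monoˡ-≤ : ∀ {m n p} → m ℕ.≤ n → 0ℚ ≤ p → m · p ≤ n · p
·-monoˡ-≤ {n = n} z≤n       0≤p = ·-nonNeg n 0≤p
·-monoˡ-≤ {p = p} (s≤s m≤n) 0≤p = +-monoʳ-≤ p (·-monoˡ-≤ m≤n 0≤p)

m·1≤n·q⇒m/n≤q : ∀ m d {q} → m · 1ℚ ≤ suc d · q → + m / suc d ≤ q
m·1≤n·q⇒m/n≤q m d m≤nq = ·-cancelˡ-≤ d (subst (_≤ _) (sym (·-/-cancel m d)) m≤nq)

n·q≤m·1⇒q≤m/n : ∀ m d {q} → suc d · q ≤ m · 1ℚ → q ≤ + m / suc d
n·q≤m·1⇒q≤m/n m d nq≤m = ·-cancelˡ-≤ d (subst (_ ≤_) (sym (·-/-cancel m d)) nq≤m)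

/-monoˡ-≤ : ∀ {m n} d → m ℕ.≤ n → + m / suc d ≤ + n / suc d
/-monoˡ-≤ {m} {n} d m≤n =
  m·1≤n·q⇒m/n≤q m d (subst (_ ≤_) (sym (·-/-cancel n d)) (·-monoˡ-≤ m≤n (nonNegative⁻¹ 1ℚ)))

sumℚ≡sum : ∀ {n} (f : Fin n → ℚ) → sumℚ f ≡ sum f
sumℚ≡sum {zero}  f = refl
sumℚ≡sum {suc n} f = cong (_+_ (f zero)) (sumℚ≡sum (f ∘ suc))

sum-mono-≤ : ∀ {n} {f g : Fin n → ℚ} → (∀ i → f i ≤ g i) → sum f ≤ sum g
sum-mono-≤ {zero}  f≤g = ≤-refl
sum-mono-≤ {suc n} f≤g = +-mono-≤ (f≤g zero) (sum-mono-≤ (f≤g ∘ suc))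

·-distrib-sum : ∀ n {k} (f : Fin k → ℚ) → n · sum f ≡ sum (λ i → n · f i)
·-distrib-sum zero    {k} f = sym (sum-replicate-zero k)
·-distrib-sum (suc n) f =
  trans (cong (_+_ (sum f)) (·-distrib-sum n f)) (sym (∑-distrib-+ f (λ i → n · f i)))

sum-indicator : ∀ {n} (c : Fin n → Bool) a →
  sum (λ i → if c i then a else 0ℚ) ≡ sumℕ (λ i → if c i then 1 else 0) · a
sum-indicator {zero}  c a = refl
sum-indicator {suc n} c a with c zero
... | true  = cong (_+_ a) (sum-indicator (c ∘ suc) a)
... | false = trans (+-identityˡ _) (sum-indicator (c ∘ suc) a)

maxℚ-upperBound : ∀ {n} (f : Fin (suc n) → ℚ) i → f i ≤ maxℚ f
maxℚ-upperBound {zero}  f zero    = ≤-refl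
maxℚ-upperBound {suc n} f zero    = p≤p⊔q (f zero) _
maxℚ-upperBound {suc n} f (suc i) = ≤-trans (maxℚ-upperBound (f ∘ suc) i) (p≤q⊔p (f zero) _)

maxℚ-least : ∀ {n} (f : Fin (suc n) → ℚ) {a} → (∀ i → f i ≤ a) → maxℚ f ≤ a
maxℚ-least {zero}  f f≤a = f≤a zero
maxℚ-least {suc n} f f≤a = ⊔-lub (f≤a zero) (maxℚ-least (f ∘ suc) (f≤a ∘ suc))

maxℕ-upperBound : ∀ {n} (f : Fin (suc n) → ℕ) i → f i ℕ.≤ maxℕ f
maxℕ-upperBound {zero}  f zero    = ℕ.≤-refl
maxℕ-upperBound {suc n} f zero    = ℕ.m≤m⊔n (f zero) _
maxℕ-upperBound {suc n} f (suc i) = ℕ.≤-trans (maxℕ-upperBound (f ∘ suc) i) (ℕ.m≤n⊔m (f zero) _)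

minℕ-lowerBound : ∀ {n} (f : Fin (suc n) → ℕ) i → minℕ f ℕ.≤ f i
minℕ-lowerBound {zero}  f zero    = ℕ.≤-refl
minℕ-lowerBound {suc n} f zero    = ℕ.m⊓n≤m (f zero) _
minℕ-lowerBound {suc n} f (suc i) = ℕ.≤-trans (ℕ.m⊓n≤n (f zero) _) (minℕ-lowerBound (f ∘ suc) i)

weight-const : ∀ {v} c (S : Subset v) → weight (λ _ → c) S ≡ ∣ S ∣ · c
weight-const c []          = refl
weight-const c (true ∷ S)  = cong (_+_ c) (weight-const c S)
weight-const c (false ∷ S) = trans (+-identityˡ _) (weight-const c S)

∑-weight≡∑-rep· : ∀ {v b} (B : Design v b) (w : Weighting v) →
  ∑[ i < b ] weight w (B i) ≡ ∑[ x < v ] (rep B x · w x)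
∑-weight≡∑-rep· {v} {b} B w = begin
  ∑[ i < b ] weight w (B i)                                   ≡⟨ sum-cong-≗ (λ i → sumℚ≡sum (indicator i)) ⟩
  ∑[ i < b ] ∑[ x < v ] (if lookup (B i) x then w x else 0ℚ)  ≡⟨ ∑-comm indicator ⟩
  ∑[ x < v ] ∑[ i < b ] (if lookup (B i) x then w x else 0ℚ)  ≡⟨ sum-cong-≗ (λ x → sum-indicator (λ i → lookup (B i) x) (w x)) ⟩
  ∑[ x < v ] (rep B x · w x)                                  ∎
  where
  open ≡-Reasoning
  indicator : Fin b → Fin v → ℚ
  indicator i x = if lookup (B i) x then w x else 0ℚ

normalised-sum : ∀ {v} {w : Weighting v} → Normalised w → sum w ≡ 1ℚ
normalised-sum {w = w} (_ , sumℚw≡1) = trans (sym (sumℚ≡sum w)) sumℚw≡1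

≤rep⇒·1≤∑-weight : ∀ {v b m} (B : Design v b) {w : Weighting v} →
  (∀ x → m ℕ.≤ rep B x) → Normalised w → m · 1ℚ ≤ ∑[ i < b ] weight w (B i)
≤rep⇒·1≤∑-weight {v} {b} {m} B {w} m≤rep w-normalised@(w≥0 , _) = begin
  m · 1ℚ                      ≡⟨ cong (m ·_) (normalised-sum w-normalised) ⟨
  m · sum w                   ≡⟨ ·-distrib-sum m w ⟩
  ∑[ x < v ] (m · w x)        ≤⟨ sum-mono-≤ (λ x → ·-monoˡ-≤ (m≤rep x) (w≥0 x)) ⟩
  ∑[ x < v ] (rep B x · w x)  ≡⟨ ∑-weight≡∑-rep· B w ⟨
  ∑[ i < b ] weight w (B i)   ∎
  where open ≤-Reasoning

rep≡⇒∑-weight≡·1 : ∀ {v b r} (B : Design v b) {w : Weighting v} →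
  (∀ x → rep B x ≡ r) → Normalised w → ∑[ i < b ] weight w (B i) ≡ r · 1ℚ
rep≡⇒∑-weight≡·1 {v} {b} {r} B {w} rep≡r w-normalised = begin
  ∑[ i < b ] weight w (B i)   ≡⟨ ∑-weight≡∑-rep· B w ⟩
  ∑[ x < v ] (rep B x · w x)  ≡⟨ sum-cong-≗ (λ x → cong (_· w x) (rep≡r x)) ⟩
  ∑[ x < v ] (r · w x)        ≡⟨ ·-distrib-sum r w ⟨
  r · sum w                   ≡⟨ cong (r ·_) (normalised-sum w-normalised) ⟩
  r · 1ℚ                      ∎
  where open ≡-Reasoning

∑-weight≤·Lw : ∀ {v b} (B : Design v (suc b)) (w : Weighting v) →
  ∑[ i < suc b ] weight w (B i) ≤ suc b · Lw B w
∑-weight≤·Lw {b = b} B w = begin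
  ∑[ i < suc b ] weight w (B i)  ≤⟨ sum-mono-≤ (maxℚ-upperBound (λ i → weight w (B i))) ⟩
  ∑[ i < suc b ] Lw B w          ≡⟨ sum-replicate (suc b) {Lw B w} ⟩
  suc b · Lw B w                 ∎
  where open ≤-Reasoning

≤rep⇒≤LD : ∀ {v b m} (B : Design v (suc b)) → (∀ x → m ℕ.≤ rep B x) → (+ m / suc b) ≤LD B
≤rep⇒≤LD {b = b} {m} B m≤rep w w-normalised =
  m·1≤n·q⇒m/n≤q m b (≤-trans (≤rep⇒·1≤∑-weight B m≤rep w-normalised) (∑-weight≤·Lw B w))

rep≡⇒Lw≤ : ∀ {v b r} (B : Design v (suc b)) {w : Weighting v} {X} →
  (∀ x → rep B x ≡ r) → Normalised w → (∀ i → weight w (B i) ≡ X) → Lw B w ≤ + r / suc b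
rep≡⇒Lw≤ {b = b} {r} B {w} {X} rep≡r w-normalised weight≡X =
  maxℚ-least _ (λ i → ≤-trans (≤-reflexive (weight≡X i)) X≤r/b)
  where
  b·X≡r : suc b · X ≡ r · 1ℚ
  b·X≡r = begin
    suc b · X                      ≡⟨ sum-replicate (suc b) {X} ⟨
    ∑[ i < suc b ] X               ≡⟨ sum-cong-≗ weight≡X ⟨
    ∑[ i < suc b ] weight w (B i)  ≡⟨ rep≡⇒∑-weight≡·1 B rep≡r w-normalised ⟩
    r · 1ℚ                         ∎
    where open ≡-Reasoning
  X≤r/b : X ≤ + r / suc b
  X≤r/b = n·q≤m·1⇒q≤m/n r b (≤-reflexive b·X≡r)

Lw≤⇒LD≤ : ∀ {v b} (B : Design v (suc b)) {w : Weighting v} {a} → Normalised w → Lw B w ≤ a → B LD≤ a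
Lw≤⇒LD≤ B {w} {a} w-normalised Lw≤a ε ε>0 =
  w , w-normalised , ≤-<-trans Lw≤a (<-respˡ-≡ (+-identityʳ a) (+-monoʳ-< a ε>0))

uniform : ∀ v → Weighting (suc v)
uniform v _ = + 1 / suc v

uniform-normalised : ∀ v → Normalised (uniform v)
uniform-normalised v = (λ _ → nonNegative⁻¹ (+ 1 / suc v) {{normalize-nonNeg 1 (suc v)}}) , (begin
  sumℚ (uniform v)            ≡⟨ sumℚ≡sum (uniform v) ⟩
  ∑[ x < suc v ] uniform v x  ≡⟨ sum-replicate (suc v) {+ 1 / suc v} ⟩
  suc v · (+ 1 / suc v)       ≡⟨ ·-/-cancel 1 v ⟩
  1ℚ                          ∎)
  where open ≡-Reasoning

weight-uniform : ∀ v (S : Subset (suc v)) → weight (uniform v) S ≡ + ∣ S ∣ / suc v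
weight-uniform v S = begin
  weight (uniform v) S      ≡⟨ weight-const (+ 1 / suc v) S ⟩
  ∣ S ∣ · (+ 1 / suc v)     ≡⟨ ·-/ ∣ S ∣ 1 v ⟩
  + (∣ S ∣ ℕ.* 1) / suc v   ≡⟨ cong (λ n → + n / suc v) (ℕ.*-identityʳ ∣ S ∣) ⟩
  + ∣ S ∣ / suc v           ∎
  where open ≡-Reasoning

≥size⇒LD≤ : ∀ {v b k} (B : Design (suc v) (suc b)) → (∀ i → ∣ B i ∣ ℕ.≤ k) → B LD≤ (+ k / suc v)
≥size⇒LD≤ {v} B size≤k = Lw≤⇒LD≤ B (uniform-normalised v) (maxℚ-least _ λ i →
  ≤-trans (≤-reflexive (weight-uniform v (B i))) (/-monoˡ-≤ v (size≤k i)))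

lemma6p3 : (v b : ℕ) (B : Design (suc v) (suc b)) → IsCovering B →
    ((+ minℕ (rep B)) / suc b) ≤LD B
    × B LD≤ ((+ maxℕ (λ i → ∣ B i ∣)) / suc v)
    × ((r : ℕ) → ((x : Fin (suc v)) → rep B x ≡ r) →
        ((i j : Fin (suc b)) → ∣ B i ∣ ≡ ∣ B j ∣) →
        B LD≡ ((+ r) / suc b))
lemma6p3 v b B _ =
  ≤rep⇒≤LD B (minℕ-lowerBound (rep B)) , ≥size⇒LD≤ B (maxℕ-upperBound (λ i → ∣ B i ∣)) , regular
  where
  regular : (r : ℕ) → ((x : Fin (suc v)) → rep B x ≡ r) →
    ((i j : Fin (suc b)) → ∣ B i ∣ ≡ ∣ B j ∣) → B LD≡ ((+ r) / suc b)
  regular r rep≡r equalSizes =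
    ≤rep⇒≤LD B (ℕ.≤-reflexive ∘ sym ∘ rep≡r) ,
    Lw≤⇒LD≤ B (uniform-normalised v) (rep≡⇒Lw≤ B rep≡r (uniform-normalised v) equalWeights)
    where
    equalWeights : ∀ i → weight (uniform v) (B i) ≡ + ∣ B zero ∣ / suc v
    equalWeights i = trans (weight-uniform v (B i)) (cong (λ n → + n / suc v) (equalSizes i zero))
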